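{- Let $(G,\sigma)$ be a signed graph with $\chi((G,\sigma))=t+1$. Then $\chi_c((G,\sigma))=t$ if and only if $(G,\sigma)$ has a $(2t,2)$-coloring.
   Context: Graphs are simple and finite. A signed graph $(G,\sigma)$ is a graph $G$ with a map $\sigma:E(G)\to\{\pm1\}$. For $x\in\mathbb{R}$ and $r>0$, $[x]_r\in[0,r)$ is the remainder of $x$ modulo $r$ and $|x|_r=\min\{[x]_r,[-x]_r\}$. For positive integers $k\ge 2d$, a $(k,d)$-coloring of $(G,\sigma)$ is a map $c:V(G)\to\mathbb{Z}_k$ such that $|c(v)-\sigma(e)c(w)|_k\ge d$ for every edge $e=vw$. The circular chromatic number is $\chi_c((G,\sigma))=\inf\{k/d : (G,\sigma)\text{ has a }(k,d)\text{ -coloring}\}$, and the chromatic number $\chi((G,\sigma))$ is the minimum $k$ such that $(G,\sigma)$ has a $(k,1)$-coloring. -}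

module Defs where

open import Data.Nat using (ℕ; zero; suc; _+_; _*_; _≤_; _<_; _⊓_)
open import Data.Integer as ℤ using (ℤ; +_; _◃_)
open import Data.Sign using (Sign)
open import Data.Fin using (Fin; toℕ)
open import Data.Bool using (Bool; true; false)
open import Data.Product using (Σ; ∃; _×_)
open import Relation.Binary.PropositionalEquality using (_≡_)
open import Relation.Nullary using (¬_)

-- A simple finite signed graph on the vertex set Fin n.
-- E u v : adjacency (symmetric, irreflexive); σ u v : sign of the edge uv
-- (only meaningful when E u v ≡ true; symmetric).
record SignedGraph : Set where
  field
    n     : ℕ
    E     : Fin n → Fin n → Bool
    E-sym : ∀ u v → E u v ≡ E v u
    E-irr : ∀ u → E u u ≡ false
    σ     : Fin n → Fin n → Sign
    σ-sym : ∀ u v → σ u v ≡ σ v u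

-- |x|_k = min([x]_k, [-x]_k)  (the k = 0 case is never used, since k ≥ 2d ≥ 2)
absMod : ℤ → ℕ → ℕ
absMod x zero    = 0
absMod x (suc m) = (x ℤ.%ℕ suc m) ⊓ ((ℤ.- x) ℤ.%ℕ suc m)

IsColoring : (G : SignedGraph) (k d : ℕ) → (Fin (SignedGraph.n G) → Fin k) → Set
IsColoring G k d c =
  1 ≤ d × 2 * d ≤ k ×
  (∀ u v → E u v ≡ true →
     d ≤ absMod ((+ toℕ (c u)) ℤ.- (σ u v ◃ toℕ (c v))) k)
  where open SignedGraph G

HasColoring : SignedGraph → ℕ → ℕ → Set
HasColoring G k d = Σ (Fin (SignedGraph.n G) → Fin k) (IsColoring G k d)

ChromaticNumberIs : SignedGraph → ℕ → Set
ChromaticNumberIs G m = HasColoring G m 1 × (∀ k → k < m → ¬ HasColoring G k 1)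

-- χ_c(G) = t (t a natural number), i.e. inf { k/d : G has a (k,d)-coloring } = t:
-- t is a lower bound, and for every m ≥ 1 some k/d < t + 1/m.
CircularChromaticNumberIs : SignedGraph → ℕ → Set
CircularChromaticNumberIs G t =
  (∀ k d → HasColoring G k d → t * d ≤ k) ×
  (∀ m → 1 ≤ m → ∃ λ k → ∃ λ d → HasColoring G k d × m * k < (m * t + 1) * d)

-- Rounding v ↦ ⌊(2t c(v) + k) / 2k⌋ mod t turns a (k,d)-colouring with k/d < t into a
-- (t,1)-colouring, which χ = t + 1 forbids; so χ_c ≥ t, and a (2t,2)-colouring gives χ_c ≤ t.
-- Conversely, take a (k,d)-colouring c with k/d < t + 1/m for m ≥ 2(2n+1). On the double
-- cover V × {±}, with arcs (u,α) → (v, α σ(uv)) and values α c(v), weight each arc by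
-- t ⌈δ/k⌉ - 1, where δ is the change of value along it. Closed walks of length at most 2n+1
-- get nonnegative weight, so shortest walks give a potential π with π q ≤ π p + w p q. Its
-- antisymmetrisation X (v,α) = π (v,α) - π (v,-α) satisfies X q - X p ≤ 2 w p q on every arc;
-- as ⌈δ/k⌉ of an arc and of its reverse sum to at most 1, X q - X p then keeps distance 2
-- from the multiples of 2t, and X (v,+) mod 2t is a (2t,2)-colouring.

module Submission where

open import Data.Bool using (Bool; true; false; _∧_; if_then_else_)
open import Data.Empty using (⊥; ⊥-elim)
open import Data.Fin as Fin using (Fin; toℕ; fromℕ<; _↑ˡ_; _↑ʳ_; splitAt)
import Data.Fin.Properties as Finₚ
open import Data.List using (_∷_; [])
open import Data.Nat as ℕ using (ℕ; zero; suc; z≤n; s≤s)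
import Data.Nat.Properties as ℕₚ
open import Data.Nat.Tactic.RingSolver using () renaming (solve-∀ to ℕ-solve-∀)
open import Data.Product using (∃; _×_; _,_; proj₁; proj₂)
open import Data.Sign as Sign using (Sign)
import Data.Sign.Properties as Signₚ
open import Data.Sum using (_⊎_; inj₁; inj₂; [_,_]′)
open import Function using (_∘_; id)
open import Function.Bundles using (_⇔_; mk⇔)
open import Relation.Binary.PropositionalEquality
open import Relation.Nullary using (yes; no; does)
open import Relation.Nullary.Decidable using (dec-true)

open import Defs

-- The integer notation is opened only in this block, so that _*_ in theorem15 is that of ℕ.
module _ where
  open import Data.Integer hiding (suc)
  open import Data.Integer.DivMod using (a≡a%ℕn+[a/ℕn]*n; n%ℕd<d)
  open import Data.Integer.Properties
  open import Data.Integer.Tactic.RingSolver using (solve-∀; solve)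

  -- Linear arithmetic is done with certificates: a system of facts 0 ≤ eᵢ is refuted by
  -- a combination of them with nonnegative coefficients that the ring solver evaluates to -1.

  NonNeg : ℤ → Set
  NonNeg x = 0ℤ ≤ x

  infixl 6 _⊕_
  infixl 7 _⊗_

  _⊕_ : ∀ {x y} → NonNeg x → NonNeg y → NonNeg (x + y)
  _⊕_ = +-mono-≤

  _⊗_ : ∀ {x y} → NonNeg x → NonNeg y → NonNeg (x * y)
  _⊗_ {+ a} {+ b} _ _ = subst NonNeg (pos-* a b) (+≤+ z≤n)

  ≤⇒NonNeg : ∀ {x y} → x ≤ y → NonNeg (y - x)
  ≤⇒NonNeg = i≤j⇒0≤j-i

  NonNeg⇒≤ : ∀ {x y} → NonNeg (y - x) → x ≤ y
  NonNeg⇒≤ = 0≤i-j⇒j≤i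

  NonNeg-ℕ : ∀ n → NonNeg (+ n)
  NonNeg-ℕ n = +≤+ z≤n

  NonNeg⇒≢-1 : ∀ {x} → NonNeg x → x ≢ -1ℤ
  NonNeg⇒≢-1 () refl

  NonNeg-or-neg : ∀ x → NonNeg x ⊎ NonNeg (- x - 1ℤ)
  NonNeg-or-neg (+ n)    = inj₁ (NonNeg-ℕ n)
  NonNeg-or-neg -[1+ n ] = inj₂ (NonNeg-ℕ n)

  <⇒NonNeg : ∀ {x y} → x < y → NonNeg (y - x - 1ℤ)
  <⇒NonNeg {x} {y} x<y = subst NonNeg (shift x y) (≤⇒NonNeg (i<j⇒suc[i]≤j x<y))
    where shift : ∀ x y → y - (1ℤ + x) ≡ y - x - 1ℤ
          shift = solve-∀

  ℕ<⇒NonNeg : ∀ {m n} → m ℕ.< n → NonNeg (+ n - + m - 1ℤ)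
  ℕ<⇒NonNeg m<n = <⇒NonNeg (+<+ m<n)

  ℕ≤⇒NonNeg : ∀ {m n} → m ℕ.≤ n → NonNeg (+ n - + m)
  ℕ≤⇒NonNeg m≤n = ≤⇒NonNeg (+≤+ m≤n)

  NonNeg-pred⇒NonNeg : ∀ {x} → NonNeg (x - 1ℤ) → NonNeg x
  NonNeg-pred⇒NonNeg {x} h = subst NonNeg (cancel x) (h ⊕ NonNeg-ℕ 1)
    where cancel : ∀ x → x - 1ℤ + 1ℤ ≡ x
          cancel = solve-∀

  record Apart (k d : ℕ) (z : ℤ) : Set where
    constructor apart
    field
      gap : ∀ i → NonNeg (z - i * + k + + d - 1ℤ) → NonNeg (+ d - (z - i * + k) - 1ℤ) → ⊥

  open Apart

  Apart-neg : ∀ {k d z} → Apart k d z → Apart k d (- z)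
  Apart-neg {k} {d} {z} F = apart λ i below above →
    gap F (- i) (subst NonNeg (eq₁ z i (+ k) (+ d)) above) (subst NonNeg (eq₂ z i (+ k) (+ d)) below)
    where eq₁ : ∀ z i k d → d - (- z - i * k) - 1ℤ ≡ z - (- i) * k + d - 1ℤ
          eq₁ = solve-∀
          eq₂ : ∀ z i k d → - z - i * k + d - 1ℤ ≡ d - (z - (- i) * k) - 1ℤ
          eq₂ = solve-∀

  Apart-+-multiple : ∀ {k d z} j → Apart k d z → Apart k d (z + j * + k)
  Apart-+-multiple {k} {d} {z} j F = apart λ i below above →
    gap F (i - j) (subst NonNeg (eq₁ z i j (+ k) (+ d)) below) (subst NonNeg (eq₂ z i j (+ k) (+ d)) above)
    where eq₁ : ∀ z i j k d → z + j * k - i * k + d - 1ℤ ≡ z - (i - j) * k + d - 1ℤ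
          eq₁ = solve-∀
          eq₂ : ∀ z i j k d → d - (z + j * k - i * k) - 1ℤ ≡ d - (z - (i - j) * k) - 1ℤ
          eq₂ = solve-∀

  absMod≡ : ∀ z k .{{_ : ℕ.NonZero k}} → absMod z k ≡ (z %ℕ k) ℕ.⊓ ((- z) %ℕ k)
  absMod≡ z (suc _) = refl

  module _ (k : ℕ) .{{_ : ℕ.NonZero k}} where

    %ℕ-least : ∀ z i → NonNeg (z - i * + k) → + (z %ℕ k) ≤ z - i * + k
    %ℕ-least z i y≥0 = NonNeg⇒≤ ([ from-quotient , ⊥-elim ∘ contra ]′ (NonNeg-or-neg (z /ℕ k - i)))
      where
        r = + (z %ℕ k)
        q = z /ℕ k
        z≡ = a≡a%ℕn+[a/ℕn]*n z k
        eq₁ : ∀ z r q i k → z ≡ r + q * k → (q - i) * k ≡ z - i * k - r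
        eq₁ _ r q i k refl = solve (r ∷ q ∷ i ∷ k ∷ [])
        eq₂ : ∀ z r q i k → z ≡ r + q * k → z - i * k + (k - r - 1ℤ) + (- (q - i) - 1ℤ) * k ≡ -1ℤ
        eq₂ _ r q i k refl = solve (r ∷ q ∷ i ∷ k ∷ [])
        from-quotient : NonNeg (q - i) → NonNeg (z - i * + k - r)
        from-quotient h = subst NonNeg (eq₁ z r q i (+ k) z≡) (h ⊗ NonNeg-ℕ k)
        contra : NonNeg (- (q - i) - 1ℤ) → ⊥
        contra h = NonNeg⇒≢-1 (y≥0 ⊕ ℕ<⇒NonNeg (n%ℕd<d z k) ⊕ h ⊗ NonNeg-ℕ k)
                              (eq₂ z r q i (+ k) z≡)

    %ℕ-gap : ∀ {d} z → d ℕ.≤ z %ℕ k → ∀ i → NonNeg (z - i * + k) → NonNeg (+ d - (z - i * + k) - 1ℤ) → ⊥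
    %ℕ-gap {d} z d≤r i y≥0 y<d =
      NonNeg⇒≢-1 (≤⇒NonNeg (%ℕ-least z i y≥0) ⊕ y<d ⊕ ℕ≤⇒NonNeg d≤r)
                 (cancel (z - i * + k) (+ (z %ℕ k)) (+ d))
      where cancel : ∀ y r d → y - r + (d - y - 1ℤ) + (r - d) ≡ -1ℤ
            cancel = solve-∀

    absMod⇒Apart : ∀ {d} z → d ℕ.≤ absMod z k → Apart k d z
    absMod⇒Apart {d} z d≤∣z∣ = apart λ i below above →
      [ (λ y≥0 → %ℕ-gap z (ℕₚ.≤-trans d≤min (ℕₚ.m⊓n≤m _ _)) i y≥0 above)
      , (λ y<0 → %ℕ-gap (- z) (ℕₚ.≤-trans d≤min (ℕₚ.m⊓n≤n _ _)) (- i)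
                   (subst NonNeg (eq₁ z i (+ k)) (y<0 ⊕ NonNeg-ℕ 1))
                   (subst NonNeg (eq₂ z i (+ k) (+ d)) below))
      ]′ (NonNeg-or-neg (z - i * + k))
      where
        d≤min = subst (d ℕ.≤_) (absMod≡ z k) d≤∣z∣
        eq₁ : ∀ z i k → - (z - i * k) - 1ℤ + 1ℤ ≡ - z - (- i) * k
        eq₁ = solve-∀
        eq₂ : ∀ z i k d → z - i * k + d - 1ℤ ≡ d - (- z - (- i) * k) - 1ℤ
        eq₂ = solve-∀

    Apart⇒%ℕ-bounds : ∀ {d} z → Apart k d z → d ℕ.≤ z %ℕ k × z %ℕ k ℕ.+ d ℕ.≤ k
    Apart⇒%ℕ-bounds {d} z F = lower , upper
      where
        r = + (z %ℕ k)
        q = z /ℕ k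
        z≡ = a≡a%ℕn+[a/ℕn]*n z k
        lower : d ℕ.≤ z %ℕ k
        lower with d ℕ.≤? z %ℕ k
        ... | yes d≤r = d≤r
        ... | no d≰r = ⊥-elim (gap F q (subst NonNeg (eq₁ z r q (+ k) (+ d) z≡) (r<d ⊕ (NonNeg-ℕ (z %ℕ k) ⊕ NonNeg-ℕ (z %ℕ k))))
                                    (subst NonNeg (eq₂ z r q (+ k) (+ d) z≡) r<d))
          where
            r<d = ℕ<⇒NonNeg (ℕₚ.≰⇒> d≰r)
            eq₁ : ∀ z r q k d → z ≡ r + q * k → d - r - 1ℤ + (r + r) ≡ z - q * k + d - 1ℤ
            eq₁ _ r q k d refl = solve (r ∷ q ∷ k ∷ d ∷ [])
            eq₂ : ∀ z r q k d → z ≡ r + q * k → d - r - 1ℤ ≡ d - (z - q * k) - 1ℤ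
            eq₂ _ r q k d refl = solve (r ∷ q ∷ k ∷ d ∷ [])
        upper : z %ℕ k ℕ.+ d ℕ.≤ k
        upper with z %ℕ k ℕ.+ d ℕ.≤? k
        ... | yes r+d≤k = r+d≤k
        ... | no r+d≰k = ⊥-elim (gap F (q + 1ℤ) (subst NonNeg (eq₁ z r q (+ k) (+ d) z≡) k<r+d)
                                             (subst NonNeg (eq₂ z r q (+ k) (+ d) z≡) (NonNeg-ℕ d ⊕ ℕ<⇒NonNeg (n%ℕd<d z k))))
          where
            k<r+d = subst (λ x → NonNeg (x - + k - 1ℤ)) (pos-+ (z %ℕ k) d) (ℕ<⇒NonNeg (ℕₚ.≰⇒> r+d≰k))
            eq₁ : ∀ z r q k d → z ≡ r + q * k → r + d - k - 1ℤ ≡ z - (q + 1ℤ) * k + d - 1ℤ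
            eq₁ _ r q k d refl = solve (r ∷ q ∷ k ∷ d ∷ [])
            eq₂ : ∀ z r q k d → z ≡ r + q * k → d + (k - r - 1ℤ) ≡ d - (z - (q + 1ℤ) * k) - 1ℤ
            eq₂ _ r q k d refl = solve (r ∷ q ∷ k ∷ d ∷ [])

    Apart⇒absMod : ∀ {d} z → Apart k d z → d ℕ.≤ absMod z k
    Apart⇒absMod {d} z F = subst (d ℕ.≤_) (sym (absMod≡ z k))
      (ℕₚ.⊓-glb (proj₁ (Apart⇒%ℕ-bounds z F)) (proj₁ (Apart⇒%ℕ-bounds (- z) (Apart-neg F))))

  signℤ : Sign → ℤ
  signℤ Sign.+ = 1ℤ
  signℤ Sign.- = -1ℤ

  ◃≡signℤ* : ∀ s n → s ◃ n ≡ signℤ s * + n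
  ◃≡signℤ* Sign.+ n = trans (+◃n≡+n n) (sym (*-identityˡ (+ n)))
  ◃≡signℤ* Sign.- n = trans (-◃n≡-n n) (sym (-1*i≡-i (+ n)))

  signℤ-* : ∀ s s′ → signℤ (s Sign.* s′) ≡ signℤ s * signℤ s′
  signℤ-* Sign.+ Sign.+ = refl
  signℤ-* Sign.+ Sign.- = refl
  signℤ-* Sign.- Sign.+ = refl
  signℤ-* Sign.- Sign.- = refl

  signℤ-opposite : ∀ s x → signℤ (Sign.opposite s) * x ≡ - (signℤ s * x)
  signℤ-opposite Sign.+ x = trans (-1*i≡-i x) (cong -_ (sym (*-identityˡ x)))
  signℤ-opposite Sign.- x = trans (*-identityˡ x) (trans (sym (neg-involutive x)) (cong -_ (sym (-1*i≡-i x))))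

  Apart-signℤ* : ∀ {k d z} s → Apart k d z → Apart k d (signℤ s * z)
  Apart-signℤ* {z = z} Sign.+ F = subst (Apart _ _) (sym (*-identityˡ z)) F
  Apart-signℤ* {z = z} Sign.- F = subst (Apart _ _) (sym (-1*i≡-i z)) (Apart-neg F)

  Apart-%ℕ : ∀ k {d} .{{_ : ℕ.NonZero k}} s x y → Apart k d (signℤ s * y - x) → Apart k d (+ (x %ℕ k) - (s ◃ (y %ℕ k)))
  Apart-%ℕ k s x y F =
    subst (Apart k _) (trans (reduce (signℤ s) (+ (x %ℕ k)) (+ (y %ℕ k)) (x /ℕ k) (y /ℕ k)
                                     (a≡a%ℕn+[a/ℕn]*n x k) (a≡a%ℕn+[a/ℕn]*n y k))
                                                (cong (λ z → + (x %ℕ k) - z) (sym (◃≡signℤ* s (y %ℕ k)))))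
                             (Apart-+-multiple (signℤ s * (y /ℕ k) - x /ℕ k) (Apart-neg F))
    where
      reduce : ∀ e {x y} rx ry qx qy → x ≡ rx + qx * + k → y ≡ ry + qy * + k →
               - (e * y - x) + (e * qy - qx) * + k ≡ rx - e * ry
      reduce e rx ry qx qy refl refl = identity e rx ry qx qy (+ k)
        where identity : ∀ e rx ry qx qy K → - (e * (ry + qy * K) - (rx + qx * K)) + (e * qy - qx) * K ≡ rx - e * ry
              identity = solve-∀

  Apart-between : ∀ {Y a a′ t} → Y ≤ + 2 * (a * + t - 1ℤ) → - Y ≤ + 2 * (a′ * + t - 1ℤ) → a + a′ ≤ 1ℤ →
                  Apart (2 ℕ.* t) 2 Y
  Apart-between {Y} {a} {a′} {t} upper lower a+a′≤1 = apart λ i below above →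
    [ (λ i≥a → NonNeg⇒≢-1 (≤⇒NonNeg upper ⊕ subst NonNeg (K≡ (λ K → Y - i * K + + 2 - 1ℤ)) below ⊕ NonNeg-ℕ 2 ⊗ (i≥a ⊗ T≥0))
                          (certificate₁ Y a (+ t) i))
    , (λ i<a → [ (λ -i≥a′ → NonNeg⇒≢-1 (≤⇒NonNeg lower ⊕ subst NonNeg (K≡ (λ K → + 2 - (Y - i * K) - 1ℤ)) above
                                          ⊕ NonNeg-ℕ 2 ⊗ (-i≥a′ ⊗ T≥0))
                                       (certificate₂ Y a′ (+ t) i))
               , (λ -i<a′ → NonNeg⇒≢-1 (i<a ⊕ -i<a′ ⊕ ≤⇒NonNeg a+a′≤1) (certificate₃ a a′ i))
               ]′ (NonNeg-or-neg (- i - a′)))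
    ]′ (NonNeg-or-neg (i - a))
    where
      T≥0 = NonNeg-ℕ t
      K≡ : ∀ (P : ℤ → ℤ) → P (+ (2 ℕ.* t)) ≡ P (+ 2 * + t)
      K≡ P = cong P (pos-* 2 t)
      certificate₁ : ∀ Y a T i → + 2 * (a * T - 1ℤ) - Y + (Y - i * (+ 2 * T) + + 2 - 1ℤ) + + 2 * ((i - a) * T) ≡ -1ℤ
      certificate₁ = solve-∀
      certificate₂ : ∀ Y a′ T i → + 2 * (a′ * T - 1ℤ) - - Y + (+ 2 - (Y - i * (+ 2 * T)) - 1ℤ) + + 2 * ((- i - a′) * T) ≡ -1ℤ
      certificate₂ = solve-∀
      certificate₃ : ∀ a a′ i → - (i - a) - 1ℤ + (- (- i - a′) - 1ℤ) + (1ℤ - (a + a′)) ≡ -1ℤ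
      certificate₃ = solve-∀

  rounding-error : ∀ s {ρ ρ′ K} → 0ℤ ≤ ρ → ρ < + 2 * K → 0ℤ ≤ ρ′ → ρ′ < + 2 * K →
                   - (+ 2 * K) ≤ (ρ - K) - signℤ s * (ρ′ - K) × (ρ - K) - signℤ s * (ρ′ - K) ≤ + 2 * K
  rounding-error Sign.+ {ρ} {ρ′} {K} ρ≥0 ρ<2K ρ′≥0 ρ′<2K =
    NonNeg⇒≤ (subst NonNeg (eq₁ ρ ρ′ K) (ρ≥0 ⊕ <⇒NonNeg ρ′<2K ⊕ NonNeg-ℕ 1)) ,
    NonNeg⇒≤ (subst NonNeg (eq₂ ρ ρ′ K) (<⇒NonNeg ρ<2K ⊕ ρ′≥0 ⊕ NonNeg-ℕ 1))
    where eq₁ : ∀ ρ ρ′ K → ρ + (+ 2 * K - ρ′ - 1ℤ) + + 1 ≡ (ρ - K) - 1ℤ * (ρ′ - K) - - (+ 2 * K)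
          eq₁ = solve-∀
          eq₂ : ∀ ρ ρ′ K → + 2 * K - ρ - 1ℤ + ρ′ + + 1 ≡ + 2 * K - ((ρ - K) - 1ℤ * (ρ′ - K))
          eq₂ = solve-∀
  rounding-error Sign.- {ρ} {ρ′} {K} ρ≥0 ρ<2K ρ′≥0 ρ′<2K =
    NonNeg⇒≤ (subst NonNeg (eq₁ ρ ρ′ K) (ρ≥0 ⊕ ρ′≥0)) ,
    NonNeg⇒≤ (subst NonNeg (eq₂ ρ ρ′ K) (<⇒NonNeg ρ<2K ⊕ <⇒NonNeg ρ′<2K ⊕ NonNeg-ℕ 2))
    where eq₁ : ∀ ρ ρ′ K → ρ + ρ′ ≡ (ρ - K) - -1ℤ * (ρ′ - K) - - (+ 2 * K)
          eq₁ = solve-∀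
          eq₂ : ∀ ρ ρ′ K → + 2 * K - ρ - 1ℤ + (+ 2 * K - ρ′ - 1ℤ) + + 2 ≡ + 2 * K - ((ρ - K) - -1ℤ * (ρ′ - K))
          eq₂ = solve-∀

  private
    round-low-certificate : ∀ z F Δ i K D T → (- (z - i * K + D - 1ℤ) - 1ℤ) * (+ 2 * T) + (F - i * T + + 1 - 1ℤ) * (+ 2 * K)
                               + (Δ - - (+ 2 * K)) + ((T * D - K - 1ℤ) + (T * D - K - 1ℤ)) + (+ 2 * T * z - Δ - + 2 * K * F) + + 1 ≡ -1ℤ
    round-low-certificate = solve-∀

    round-high-certificate : ∀ z F Δ i K D T → (- (D - (z - i * K) - 1ℤ) - 1ℤ) * (+ 2 * T) + (+ 1 - (F - i * T) - 1ℤ) * (+ 2 * K)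
                                + (+ 2 * K - Δ) + ((T * D - K - 1ℤ) + (T * D - K - 1ℤ)) + (+ 2 * K * F - (+ 2 * T * z - Δ)) + + 1 ≡ -1ℤ
    round-high-certificate = solve-∀

  Apart-round : ∀ {k d t z F Δ} → Apart k d z → k ℕ.< t ℕ.* d → + 2 * + k * F ≡ + 2 * + t * z - Δ →
                - (+ 2 * + k) ≤ Δ → Δ ≤ + 2 * + k → Apart t 1 F
  Apart-round {k} {d} {t} {z} {F} {Δ} z-apart k<td 2kF≡ Δ≥-2k Δ≤2k = apart λ i below above →
    gap z-apart i
      ([ id , (λ h → ⊥-elim (NonNeg⇒≢-1 (h ⊗ 2T≥0 ⊕ below ⊗ 2K≥0 ⊕ ≤⇒NonNeg Δ≥-2k ⊕ 2[td-k-1]≥0 ⊕ exact₁ ⊕ NonNeg-ℕ 1)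
                                (round-low-certificate z F Δ i K D T)))
       ]′ (NonNeg-or-neg (z - i * K + D - 1ℤ)))
      ([ id , (λ h → ⊥-elim (NonNeg⇒≢-1 (h ⊗ 2T≥0 ⊕ above ⊗ 2K≥0 ⊕ ≤⇒NonNeg Δ≤2k ⊕ 2[td-k-1]≥0 ⊕ exact₂ ⊕ NonNeg-ℕ 1)
                                (round-high-certificate z F Δ i K D T)))
       ]′ (NonNeg-or-neg (D - (z - i * K) - 1ℤ)))
    where
      K = + k
      T = + t
      D = + d
      td>k = subst (λ x → NonNeg (x - K - 1ℤ)) (pos-* t d) (ℕ<⇒NonNeg k<td)
      2[td-k-1]≥0 = td>k ⊕ td>k
      2T≥0 = NonNeg-ℕ 2 ⊗ NonNeg-ℕ t
      2K≥0 = NonNeg-ℕ 2 ⊗ NonNeg-ℕ k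
      exact₁ : NonNeg (+ 2 * T * z - Δ - + 2 * K * F)
      exact₁ = subst NonNeg (sym (trans (cong (λ y → + 2 * T * z - Δ - y) 2kF≡) (+-inverseʳ (+ 2 * T * z - Δ)))) (NonNeg-ℕ 0)
      exact₂ : NonNeg (+ 2 * K * F - (+ 2 * T * z - Δ))
      exact₂ = subst NonNeg (sym (trans (cong (λ y → y - (+ 2 * T * z - Δ)) 2kF≡) (+-inverseʳ (+ 2 * T * z - Δ)))) (NonNeg-ℕ 0)

  -- A closed walk of length L in the lifted colouring winds A times around the circle of
  -- length K, with L D ≤ A K; when K/D < T + 1/M and M is large, this forces L ≤ A T.
  closed-walk-bound : ∀ {A L K D T M} → 1ℤ ≤ L → 1ℤ ≤ D → 0ℤ ≤ K → 0ℤ ≤ M →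
                      L * D ≤ A * K → A ≤ L * + 2 → L * + 2 ≤ M → M * K < (M * T + 1ℤ) * D → L ≤ A * T
  closed-walk-bound {A} {L} {K} {D} {T} {M} L≥1 D≥1 K≥0 M≥0 LD≤AK A≤2L 2L≤M MK<[MT+1]D with L ≤? A * T
  ... | yes L≤AT = L≤AT
  ... | no  L≰AT = [ winding≥1 , winding≤0 ]′ (NonNeg-or-neg (A - 1ℤ))
    where
      AT<L = <⇒NonNeg (≰⇒> L≰AT)
      D≥0 = NonNeg-pred⇒NonNeg {D} (≤⇒NonNeg D≥1)
      winding≥1 : NonNeg (A - 1ℤ) → L ≤ A * T
      winding≥1 A≥1 = ⊥-elim (NonNeg⇒≢-1
        (M≥0 ⊗ ≤⇒NonNeg LD≤AK ⊕ M≥0 ⊗ D≥0 ⊗ AT<L ⊕ NonNeg-pred⇒NonNeg {A} A≥1 ⊗ <⇒NonNeg MK<[MT+1]D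
          ⊕ (≤⇒NonNeg 2L≤M ⊕ ≤⇒NonNeg A≤2L) ⊗ D≥0 ⊕ A≥1)
        (certificate A L K D T M))
        where certificate : ∀ A L K D T M → M * (A * K - L * D) + M * D * (L - A * T - 1ℤ) + A * ((M * T + 1ℤ) * D - M * K - 1ℤ)
                                             + (M - L * + 2 + (L * + 2 - A)) * D + (A - 1ℤ) ≡ -1ℤ
              certificate = solve-∀
      winding≤0 : NonNeg (- (A - 1ℤ) - 1ℤ) → L ≤ A * T
      winding≤0 A≤0 = ⊥-elim (NonNeg⇒≢-1
        (A≤0 ⊗ K≥0 ⊕ ≤⇒NonNeg LD≤AK ⊕ L≥1′ ⊗ D≥1′ ⊕ L≥1′ ⊕ D≥1′)
        (certificate A L K D))
        where L≥1′ = ≤⇒NonNeg L≥1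
              D≥1′ = ≤⇒NonNeg D≥1
              certificate : ∀ A L K D → (- (A - 1ℤ) - 1ℤ) * K + (A * K - L * D) + (L - 1ℤ) * (D - 1ℤ) + (L - 1ℤ) + (D - 1ℤ) ≡ -1ℤ
              certificate = solve-∀

  minimum : ∀ M → (Fin M → ℤ) → ℤ → ℤ
  minimum zero    f z = z
  minimum (suc M) f z = f Fin.zero ⊓ minimum M (f ∘ Fin.suc) z

  minimum≤init : ∀ M f z → minimum M f z ≤ z
  minimum≤init zero    f z = ≤-refl
  minimum≤init (suc M) f z = ≤-trans (i⊓j≤j _ _) (minimum≤init M (f ∘ Fin.suc) z)

  minimum≤ : ∀ M f z j → minimum M f z ≤ f j
  minimum≤ (suc M) f z Fin.zero    = i⊓j≤i _ _
  minimum≤ (suc M) f z (Fin.suc j) = ≤-trans (i⊓j≤j _ _) (minimum≤ M (f ∘ Fin.suc) z j)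

  minimum-attained : ∀ M f z → minimum M f z ≡ z ⊎ ∃ λ j → minimum M f z ≡ f j
  minimum-attained zero    f z = inj₁ refl
  minimum-attained (suc M) f z with ⊓-sel (f Fin.zero) (minimum M (f ∘ Fin.suc) z) | minimum-attained M (f ∘ Fin.suc) z
  ... | inj₁ eq | _              = inj₂ (Fin.zero , eq)
  ... | inj₂ eq | inj₁ eq′       = inj₁ (trans eq eq′)
  ... | inj₂ eq | inj₂ (j , eq′) = inj₂ (Fin.suc j , trans eq eq′)

  module Walks {P : Set} (Arc : P → P → Bool) where

    IsWalk : (ℕ → P) → ℕ → Set
    IsWalk v l = ∀ i → i ℕ.< l → Arc (v i) (v (suc i)) ≡ true

    weight : (P → P → ℤ) → (ℕ → P) → ℕ → ℤ
    weight w v zero    = 0ℤ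
    weight w v (suc l) = weight w v l + w (v l) (v (suc l))

    Agree : (ℕ → P) → (ℕ → P) → ℕ → Set
    Agree u v l = ∀ i → i ℕ.≤ l → u i ≡ v i

    weight-cong : ∀ w {u v} l → Agree u v l → weight w u l ≡ weight w v l
    weight-cong w zero    eq = refl
    weight-cong w (suc l) eq = cong₂ _+_ (weight-cong w l (λ i i≤l → eq i (ℕₚ.m≤n⇒m≤1+n i≤l)))
                                         (cong₂ w (eq l (ℕₚ.n≤1+n l)) (eq (suc l) ℕₚ.≤-refl))

    IsWalk-cong : ∀ {u v} l → Agree u v l → IsWalk u l → IsWalk v l
    IsWalk-cong l eq W i i<l = subst₂ (λ x y → Arc x y ≡ true) (eq i (ℕₚ.<⇒≤ i<l)) (eq (suc i) i<l) (W i i<l)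

    weight-++ : ∀ w v a l → weight w v (a ℕ.+ l) ≡ weight w v a + weight w (λ i → v (a ℕ.+ i)) l
    weight-++ w v a zero    = trans (cong (weight w v) (ℕₚ.+-identityʳ a)) (sym (+-identityʳ _))
    weight-++ w v a (suc l) = begin
      weight w v (a ℕ.+ suc l)                                          ≡⟨ cong (weight w v) (ℕₚ.+-suc a l) ⟩
      weight w v (a ℕ.+ l) + w (v (a ℕ.+ l)) (v (suc (a ℕ.+ l)))          ≡⟨ cong (_+ _) (weight-++ w v a l) ⟩
      weight w v a + weight w v′ l + w (v′ l) (v (suc (a ℕ.+ l)))        ≡⟨ +-assoc (weight w v a) _ _ ⟩
      weight w v a + (weight w v′ l + w (v′ l) (v (suc (a ℕ.+ l))))      ≡⟨ cong (λ i → weight w v a + (weight w v′ l + w (v′ l) (v i))) (sym (ℕₚ.+-suc a l)) ⟩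
      weight w v a + weight w v′ (suc l)                                ∎
      where open ≡-Reasoning
            v′ = λ i → v (a ℕ.+ i)

    IsWalk-prefix : ∀ v a l → IsWalk v (a ℕ.+ l) → IsWalk v a
    IsWalk-prefix v a l W i i<a = W i (ℕₚ.<-≤-trans i<a (ℕₚ.m≤m+n a l))

    IsWalk-suffix : ∀ v a l → IsWalk v (a ℕ.+ l) → IsWalk (λ i → v (a ℕ.+ i)) l
    IsWalk-suffix v a l W i i<l =
      subst (λ x → Arc (v (a ℕ.+ i)) (v x) ≡ true) (sym (ℕₚ.+-suc a i)) (W (a ℕ.+ i) (ℕₚ.+-monoʳ-< a i<l))

    IsWalk-++ : ∀ v a l → IsWalk v a → IsWalk (λ i → v (a ℕ.+ i)) l → IsWalk v (a ℕ.+ l)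
    IsWalk-++ v a l W₁ W₂ i i<a+l with i ℕ.<? a
    ... | yes i<a = W₁ i i<a
    ... | no i≮a  = subst₂ (λ x y → Arc (v x) (v y) ≡ true) (ℕₚ.m+[n∸m]≡n a≤i)
                      (trans (ℕₚ.+-suc a (i ℕ.∸ a)) (cong suc (ℕₚ.m+[n∸m]≡n a≤i)))
                      (W₂ (i ℕ.∸ a) (ℕₚ.+-cancelˡ-< a _ _ (subst (ℕ._< a ℕ.+ l) (sym (ℕₚ.m+[n∸m]≡n a≤i)) i<a+l)))
      where a≤i = ℕₚ.≮⇒≥ i≮a

    weight-tele : ∀ (b : P → ℤ) v l → weight (λ p q → b q - b p) v l ≡ b (v l) - b (v 0)
    weight-tele b v zero    = sym (+-inverseʳ (b (v 0)))
    weight-tele b v (suc l) = trans (cong (_+ (b (v (suc l)) - b (v l))) (weight-tele b v l))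
                                    (telescope (b (v l)) (b (v 0)) (b (v (suc l))))
      where telescope : ∀ x y z → x - y + (z - x) ≡ z - y
            telescope = solve-∀

    weight-affine : ∀ f c e v l → weight (λ p q → f p q * c + e) v l ≡ weight f v l * c + + l * e
    weight-affine f c e v zero    = refl
    weight-affine f c e v (suc l) = begin
      weight g v l + (x * c + e)                  ≡⟨ cong (_+ (x * c + e)) (weight-affine f c e v l) ⟩
      weight f v l * c + + l * e + (x * c + e)    ≡⟨ regroup (weight f v l) x c (+ l) e ⟩
      (weight f v l + x) * c + (1ℤ + + l) * e     ≡⟨ cong (λ n → (weight f v l + x) * c + n * e) (sym (pos-+ 1 l)) ⟩
      weight f v (suc l) * c + + suc l * e        ∎
      where open ≡-Reasoning
            g = λ p q → f p q * c + e
            x = f (v l) (v (suc l))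
            regroup : ∀ s x c l e → s * c + l * e + (x * c + e) ≡ (s + x) * c + (1ℤ + l) * e
            regroup = solve-∀

    weight-mono : ∀ {f g} v l → IsWalk v l → (∀ p q → Arc p q ≡ true → f p q ≤ g p q) → weight f v l ≤ weight g v l
    weight-mono v zero    W f≤g = ≤-refl
    weight-mono v (suc l) W f≤g = +-mono-≤ (weight-mono v l (λ i i<l → W i (ℕₚ.m≤n⇒m≤1+n i<l)) f≤g) (f≤g _ _ (W l ℕₚ.≤-refl))

    weight-const : ∀ e v l → weight (λ _ _ → e) v l ≡ + l * e
    weight-const e v zero    = refl
    weight-const e v (suc l) = trans (cong (_+ e) (weight-const e v l)) (trans (one-more (+ l) e) (cong (_* e) (sym (pos-+ 1 l))))
      where one-more : ∀ l e → l * e + e ≡ (1ℤ + l) * e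
            one-more = solve-∀

    snoc : (ℕ → P) → ℕ → P → ℕ → P
    snoc v zero    q zero    = v zero
    snoc v zero    q (suc i) = q
    snoc v (suc l) q zero    = v zero
    snoc v (suc l) q (suc i) = snoc (λ j → v (suc j)) l q i

    snoc-≤ : ∀ v l q i → i ℕ.≤ l → snoc v l q i ≡ v i
    snoc-≤ v zero    q zero    _         = refl
    snoc-≤ v (suc l) q zero    _         = refl
    snoc-≤ v (suc l) q (suc i) (s≤s i≤l) = snoc-≤ (λ j → v (suc j)) l q i i≤l

    snoc-last : ∀ v l q → snoc v l q (suc l) ≡ q
    snoc-last v zero    q = refl
    snoc-last v (suc l) q = snoc-last (λ j → v (suc j)) l q

    module _ (w : P → P → ℤ) (v : ℕ → P) (l : ℕ) {q : P} (W : IsWalk v l) (arc : Arc (v l) q ≡ true) where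

      private
        v≈snoc : Agree v (snoc v l q) l
        v≈snoc i i≤l = sym (snoc-≤ v l q i i≤l)

      IsWalk-snoc : IsWalk (snoc v l q) (suc l)
      IsWalk-snoc i i<1+l with ℕₚ.m≤n⇒m<n∨m≡n (ℕₚ.≤-pred i<1+l)
      ... | inj₁ i<l  = IsWalk-cong l v≈snoc W i i<l
      ... | inj₂ refl = subst₂ (λ x y → Arc x y ≡ true) (v≈snoc l ℕₚ.≤-refl) (sym (snoc-last v l q)) arc

      weight-snoc : weight w (snoc v l q) (suc l) ≡ weight w v l + w (v l) q
      weight-snoc = cong₂ _+_ (sym (weight-cong w l v≈snoc)) (cong₂ w (snoc-≤ v l q l ℕₚ.≤-refl) (snoc-last v l q))

    splice : (ℕ → P) → ℕ → (ℕ → P) → ℕ → P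
    splice v zero    u i       = u i
    splice v (suc a) u zero    = v zero
    splice v (suc a) u (suc i) = splice (λ j → v (suc j)) a u i

    splice-< : ∀ v a u i → i ℕ.< a → splice v a u i ≡ v i
    splice-< v (suc a) u zero    _         = refl
    splice-< v (suc a) u (suc i) (s≤s i<a) = splice-< (λ j → v (suc j)) a u i i<a

    splice-+ : ∀ v a u i → splice v a u (a ℕ.+ i) ≡ u i
    splice-+ v zero    u i = refl
    splice-+ v (suc a) u i = splice-+ (λ j → v (suc j)) a u i

    record ShorterWalk (w : P → P → ℤ) (v : ℕ → P) (l bound : ℕ) : Set where
      constructor shorter
      field
        walk      : ℕ → P
        length    : ℕ
        length≤   : length ℕ.≤ bound
        isWalk    : IsWalk walk length
        same-end  : walk length ≡ v l
        weight≤   : weight w walk length ≤ weight w v l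

    remove-cycle : ∀ w v a c r → v a ≡ v (a ℕ.+ suc c) → IsWalk v (a ℕ.+ (suc c ℕ.+ r)) →
                   NonNeg (weight w (λ i → v (a ℕ.+ i)) (suc c)) →
                   ShorterWalk w v (a ℕ.+ (suc c ℕ.+ r)) (a ℕ.+ r)
    remove-cycle w v a c r closed W cycle≥0 =
      shorter v′ (a ℕ.+ r) ℕₚ.≤-refl W′ (splice-+ v a u r) (NonNeg⇒≤ (subst NonNeg weight-drop cycle≥0))
      where
        u : ℕ → P
        u i = v (a ℕ.+ (suc c ℕ.+ i))
        v′ = splice v a u
        v≈v′ : Agree v v′ a
        v≈v′ i i≤a with ℕₚ.m≤n⇒m<n∨m≡n i≤a
        ... | inj₁ i<a  = sym (splice-< v a u i i<a)
        ... | inj₂ refl = begin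
          v i                               ≡⟨ closed ⟩
          v (i ℕ.+ suc c)                   ≡⟨ cong (λ x → v (i ℕ.+ x)) (sym (ℕₚ.+-identityʳ (suc c))) ⟩
          u 0                               ≡⟨ sym (splice-+ v i u 0) ⟩
          v′ (i ℕ.+ 0)                      ≡⟨ cong v′ (ℕₚ.+-identityʳ i) ⟩
          v′ i                              ∎
          where open ≡-Reasoning
        u≈v′ : Agree u (λ i → v′ (a ℕ.+ i)) r
        u≈v′ i _ = sym (splice-+ v a u i)
        W′ : IsWalk v′ (a ℕ.+ r)
        W′ = IsWalk-++ v′ a r (IsWalk-cong a v≈v′ (IsWalk-prefix v a _ W))
                              (IsWalk-cong r u≈v′ (IsWalk-suffix (λ i → v (a ℕ.+ i)) (suc c) r (IsWalk-suffix v a _ W)))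
        weight-drop : weight w (λ i → v (a ℕ.+ i)) (suc c) ≡ weight w v (a ℕ.+ (suc c ℕ.+ r)) - weight w v′ (a ℕ.+ r)
        weight-drop = begin
          C                            ≡⟨ cancel (weight w v a) C (weight w u r) ⟩
          (A + (C + U)) - (A + U)      ≡⟨ sym (cong₂ _-_ (trans (weight-++ w v a _) (cong (λ x → A + x) (weight-++ w _ (suc c) r)))
                                                        (trans (weight-++ w v′ a r) (cong₂ _+_ (sym (weight-cong w a v≈v′)) (sym (weight-cong w r u≈v′))))) ⟩
          weight w v (a ℕ.+ (suc c ℕ.+ r)) - weight w v′ (a ℕ.+ r) ∎
          where open ≡-Reasoning
                A = weight w v a
                C = weight w (λ i → v (a ℕ.+ i)) (suc c)
                U = weight w u r
                cancel : ∀ x y z → y ≡ x + (y + z) - (x + z)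
                cancel = solve-∀

    module ShortestWalks (N : ℕ) (enc : P → Fin N) (dec : Fin N → P) (dec∘enc : ∀ p → dec (enc p) ≡ p)
                         (w : P → P → ℤ)
                         (closed-walks≥0 : ∀ v l → l ℕ.≤ suc N → IsWalk v l → v l ≡ v 0 → NonNeg (weight w v l)) where

      relax : (P → ℤ) → P → P → ℤ
      relax π p q = if Arc p q then π p + w p q else π q

      relax-arc : ∀ π {p q} → Arc p q ≡ true → relax π p q ≡ π p + w p q
      relax-arc π arc rewrite arc = refl

      -- shortest i q is the least weight of a walk with at most i arcs ending at q
      shortest : ℕ → P → ℤ
      shortest zero    q = 0ℤ
      shortest (suc i) q = minimum N (λ j → relax (shortest i) (dec j) q) (shortest i q)

      shortest-step : ∀ i {p q} → Arc p q ≡ true → shortest (suc i) q ≤ shortest i p + w p q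
      shortest-step i {p} {q} arc = begin
        shortest (suc i) q                  ≤⟨ minimum≤ N _ (shortest i q) (enc p) ⟩
        relax (shortest i) (dec (enc p)) q  ≡⟨ cong (λ x → relax (shortest i) x q) (dec∘enc p) ⟩
        relax (shortest i) p q              ≡⟨ relax-arc (shortest i) arc ⟩
        shortest i p + w p q                ∎
        where open ≤-Reasoning

      shortest≤weight : ∀ i v l → l ℕ.≤ i → IsWalk v l → shortest i (v l) ≤ weight w v l
      shortest≤weight zero    v zero z≤n W = ≤-refl
      shortest≤weight (suc i) v l l≤1+i W with ℕₚ.m≤n⇒m<n∨m≡n l≤1+i
      ... | inj₁ l<1+i = ≤-trans (minimum≤init N _ _) (shortest≤weight i v l (ℕₚ.≤-pred l<1+i) W)
      ... | inj₂ refl  = ≤-trans (shortest-step i (W i ℕₚ.≤-refl))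
                                 (+-monoˡ-≤ _ (shortest≤weight i v i ℕₚ.≤-refl (IsWalk-prefix v i 1 (subst (IsWalk v) (ℕₚ.+-comm 1 i) W))))

      record Realises (i : ℕ) (q : P) : Set where
        constructor realises
        field
          walk    : ℕ → P
          length  : ℕ
          length≤ : length ℕ.≤ i
          isWalk  : IsWalk walk length
          end     : walk length ≡ q
          weight≡ : weight w walk length ≡ shortest i q

      Realises-suc : ∀ {i q} → Realises i q → shortest (suc i) q ≡ shortest i q → Realises (suc i) q
      Realises-suc (realises v l l≤i W end eq′) eq = realises v l (ℕₚ.m≤n⇒m≤1+n l≤i) W end (trans eq′ (sym eq))

      Realises-snoc : ∀ {i p q} → Realises i p → Arc p q ≡ true → shortest (suc i) q ≡ shortest i p + w p q →
                      Realises (suc i) q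
      Realises-snoc (realises v l l≤i W refl eq′) arc eq =
        realises (snoc v l _) (suc l) (s≤s l≤i) (IsWalk-snoc w v l W arc) (snoc-last v l _)
                 (trans (weight-snoc w v l W arc) (trans (cong (_+ _) eq′) (sym eq)))

      shortest-realised : ∀ i q → Realises i q
      shortest-realised zero    q = realises (λ _ → q) 0 z≤n (λ _ ()) refl refl
      shortest-realised (suc i) q with minimum-attained N (λ j → relax (shortest i) (dec j) q) (shortest i q)
      ... | inj₁ eq       = Realises-suc (shortest-realised i q) eq
      ... | inj₂ (j , eq) with Arc (dec j) q in arc
      ...   | true  = Realises-snoc (shortest-realised i (dec j)) arc eq
      ...   | false = Realises-suc (shortest-realised i q) eq

      shortcut : ∀ v → IsWalk v (suc N) → ShorterWalk w v (suc N) N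
      shortcut v W with Finₚ.pigeonhole (s≤s (ℕₚ.n≤1+n N)) (λ j → enc (v (toℕ j)))
      ... | i , j , i<j , same = from-repeat (toℕ i) (toℕ j) i<j (ℕₚ.≤-pred (Finₚ.toℕ<n j))
                                   (trans (sym (dec∘enc _)) (trans (cong dec same) (dec∘enc _)))
        where
          from-repeat : ∀ a b → a ℕ.< b → b ℕ.≤ suc N → v a ≡ v b → ShorterWalk w v (suc N) N
          from-repeat a b a<b b≤1+N repeat =
            shorter walk length (ℕₚ.≤-trans length≤ a+r≤N) isWalk (trans same-end (cong v split))
                    (subst (λ x → weight w walk length ≤ weight w v x) split weight≤)
            where
              c = b ℕ.∸ suc a
              r = suc N ℕ.∸ b
              b≡ : a ℕ.+ suc c ≡ b
              b≡ = trans (ℕₚ.+-suc a c) (ℕₚ.m+[n∸m]≡n a<b)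
              split : a ℕ.+ (suc c ℕ.+ r) ≡ suc N
              split = trans (sym (ℕₚ.+-assoc a (suc c) r)) (trans (cong (ℕ._+ r) b≡) (ℕₚ.m+[n∸m]≡n b≤1+N))
              a+r≤N : a ℕ.+ r ℕ.≤ N
              a+r≤N = ℕₚ.≤-pred (subst (suc (a ℕ.+ r) ℕ.≤_) split
                        (subst (ℕ._≤ a ℕ.+ (suc c ℕ.+ r)) (ℕₚ.+-suc a r) (ℕₚ.+-monoʳ-≤ a (s≤s (ℕₚ.m≤n+m r c)))))
              W′ = subst (IsWalk v) (sym split) W
              cycle = λ i → v (a ℕ.+ i)
              cycle≥0 : NonNeg (weight w cycle (suc c))
              cycle≥0 = closed-walks≥0 cycle (suc c)
                          (subst (suc c ℕ.≤_) split (ℕₚ.≤-trans (ℕₚ.m≤m+n (suc c) r) (ℕₚ.m≤n+m _ a)))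
                          (IsWalk-prefix cycle (suc c) r (IsWalk-suffix v a _ W′))
                          (trans (cong v b≡) (trans (sym repeat) (cong v (sym (ℕₚ.+-identityʳ a)))))
              open ShorterWalk (remove-cycle w v a c r (trans repeat (cong v (sym b≡))) W′ cycle≥0)

      shortest-feasible : ∀ {p q} → Arc p q ≡ true → shortest N q ≤ shortest N p + w p q
      shortest-feasible {p} {q} arc with shortest-realised N p
      ... | realises v l l≤N W refl eq with ℕₚ.m≤n⇒m<n∨m≡n l≤N
      ...   | inj₁ l<N  = subst₂ (λ x y → shortest N x ≤ y) (snoc-last v l q) (trans (weight-snoc w v l W arc) (cong (_+ _) eq))
                            (shortest≤weight N (snoc v l q) (suc l) l<N (IsWalk-snoc w v l W arc))
      ...   | inj₂ refl with shortcut (snoc v l q) (IsWalk-snoc w v l W arc)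
      ...     | shorter v′ l′ l′≤N W′ end weight≤ = begin
        shortest N q                          ≡⟨ cong (shortest N) (trans (sym (snoc-last v l q)) (sym end)) ⟩
        shortest N (v′ l′)                    ≤⟨ shortest≤weight N v′ l′ l′≤N W′ ⟩
        weight w v′ l′                        ≤⟨ weight≤ ⟩
        weight w (snoc v l q) (suc l)         ≡⟨ trans (weight-snoc w v l W arc) (cong (_+ _) eq) ⟩
        shortest N (v l) + w (v l) q          ∎
        where open ≤-Reasoning

  module Cover (G : SignedGraph) where
    open SignedGraph G

    Vertex : Set
    Vertex = Fin n × Sign

    mirror : Vertex → Vertex
    mirror (v , α) = v , Sign.opposite α

    Arc : Vertex → Vertex → Bool
    Arc (u , α) (v , β) = E u v ∧ does (β Signₚ.≟ α Sign.* σ u v)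

    arc⇒edge : ∀ {u α v β} → Arc (u , α) (v , β) ≡ true → E u v ≡ true × β ≡ α Sign.* σ u v
    arc⇒edge {u} {α} {v} {β} arc with E u v | β Signₚ.≟ α Sign.* σ u v
    ... | true | yes eq = refl , eq

    edge⇒arc : ∀ {u α v β} → E u v ≡ true → β ≡ α Sign.* σ u v → Arc (u , α) (v , β) ≡ true
    edge⇒arc {u} {α} {v} edge refl rewrite edge = dec-true (α Sign.* σ u v Signₚ.≟ α Sign.* σ u v) refl

    private
      α*s*s≡α : ∀ α s → α Sign.* s Sign.* s ≡ α
      α*s*s≡α α s = trans (Signₚ.*-assoc α s s) (trans (cong (α Sign.*_) (Signₚ.s*s≡+ s)) (Signₚ.*-identityʳ α))

    Arc-sym : ∀ p q → Arc p q ≡ true → Arc q p ≡ true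
    Arc-sym (u , α) (v , β) arc with arc⇒edge {u} {α} {v} {β} arc
    ... | edge , refl = edge⇒arc {v} {α Sign.* σ u v} {u} (trans (E-sym v u) edge)
                          (trans (sym (α*s*s≡α α (σ u v))) (cong (α Sign.* σ u v Sign.*_) (σ-sym u v)))

    Arc-mirror : ∀ p q → Arc p q ≡ true → Arc (mirror q) (mirror p) ≡ true
    Arc-mirror (u , α) (v , β) arc with arc⇒edge {u} {α} {v} {β} arc
    ... | edge , refl = edge⇒arc {v} {Sign.opposite (α Sign.* σ u v)} {u} (trans (E-sym v u) edge)
                          (trans (sym (trans (Signₚ.*-assoc Sign.- (α Sign.* σ u v) (σ u v)) (cong Sign.opposite (α*s*s≡α α (σ u v)))))
                                 (cong (Sign.opposite (α Sign.* σ u v) Sign.*_) (σ-sym u v)))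

    size : ℕ
    size = n ℕ.+ n

    encode : Vertex → Fin size
    encode (v , Sign.+) = v ↑ˡ n
    encode (v , Sign.-) = n ↑ʳ v

    decode : Fin size → Vertex
    decode j = [ (_, Sign.+) , (_, Sign.-) ]′ (splitAt n j)

    decode∘encode : ∀ p → decode (encode p) ≡ p
    decode∘encode (v , Sign.+) = cong [ (_, Sign.+) , (_, Sign.-) ]′ (Finₚ.splitAt-↑ˡ n v n)
    decode∘encode (v , Sign.-) = cong [ (_, Sign.+) , (_, Sign.-) ]′ (Finₚ.splitAt-↑ʳ n n v)

    open Walks Arc public

    module Lift (k d : ℕ) .{{_ : ℕ.NonZero k}} (c : Fin n → Fin k) (1≤d : 1 ℕ.≤ d)
                (c-apart : ∀ u v → E u v ≡ true → Apart k d (+ toℕ (c u) - (σ u v ◃ toℕ (c v)))) where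

      lift : Vertex → ℤ
      lift (v , α) = signℤ α * + toℕ (c v)

      lift-range : ∀ p → lift p < + k × - + k < lift p
      lift-range (v , Sign.+) = subst (λ y → y < + k × - + k < y) (sym (*-identityˡ _))
        (+<+ (Finₚ.toℕ<n (c v)) , <-≤-trans (neg-mono-< (+<+ (ℕ.>-nonZero⁻¹ k))) (+≤+ z≤n))
      lift-range (v , Sign.-) = subst (λ y → y < + k × - + k < y) (sym (-1*i≡-i _))
        (≤-<-trans (neg-mono-≤ (+≤+ z≤n)) (+<+ (ℕ.>-nonZero⁻¹ k)) , neg-mono-< (+<+ (Finₚ.toℕ<n (c v))))

      lift-mirror : ∀ p → lift (mirror p) ≡ - lift p
      lift-mirror (v , α) = signℤ-opposite α (+ toℕ (c v))

      δ : Vertex → Vertex → ℤ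
      δ p q = lift q - lift p

      Apart-δ : ∀ p q → Arc p q ≡ true → Apart k d (δ p q)
      Apart-δ (u , α) (v , β) arc with arc⇒edge {u} {α} {v} {β} arc
      ... | edge , refl = subst (Apart k d) (eq (signℤ α) (signℤ (σ u v)) (+ toℕ (c u)) (+ toℕ (c v)) (signℤ-* α (σ u v)))
                            (Apart-signℤ* α (Apart-neg (subst (λ x → Apart k d (+ toℕ (c u) - x)) (◃≡signℤ* (σ u v) _) (c-apart u v edge))))
        where eq : ∀ a s x y {as} → as ≡ a * s → a * - (x - s * y) ≡ as * y - a * x
              eq a s x y refl = solve (a ∷ s ∷ x ∷ y ∷ [])

      -- Since δ p q is not a multiple of k on arcs, this is its ceiling quotient ⌈δ p q / k⌉.
      ⌈δ⌉ : Vertex → Vertex → ℤ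
      ⌈δ⌉ p q = δ p q /ℕ k + 1ℤ

      δ-bounds : ∀ p q → Arc p q ≡ true → (⌈δ⌉ p q - 1ℤ) * + k + + d ≤ δ p q × δ p q ≤ ⌈δ⌉ p q * + k - + d
      δ-bounds p q arc with Apart⇒%ℕ-bounds k (δ p q) (Apart-δ p q arc)
      ... | d≤r , r+d≤k =
        NonNeg⇒≤ (subst NonNeg (eq₁ _ r quot (+ k) (+ d) z≡) (ℕ≤⇒NonNeg d≤r)) ,
        NonNeg⇒≤ (subst NonNeg (eq₂ _ r quot (+ k) (+ d) z≡) (subst (λ x → NonNeg (+ k - x)) (pos-+ (δ p q %ℕ k) d) (ℕ≤⇒NonNeg r+d≤k)))
        where
          r = + (δ p q %ℕ k)
          quot = δ p q /ℕ k
          z≡ = a≡a%ℕn+[a/ℕn]*n (δ p q) k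
          eq₁ : ∀ z r q k d → z ≡ r + q * k → r - d ≡ z - ((q + 1ℤ - 1ℤ) * k + d)
          eq₁ _ r q k d refl = solve (r ∷ q ∷ k ∷ d ∷ [])
          eq₂ : ∀ z r q k d → z ≡ r + q * k → k - (r + d) ≡ (q + 1ℤ) * k - d - z
          eq₂ _ r q k d refl = solve (r ∷ q ∷ k ∷ d ∷ [])

      ⌈δ⌉≤2 : ∀ p q → Arc p q ≡ true → ⌈δ⌉ p q ≤ + 2
      ⌈δ⌉≤2 p q arc with ⌈δ⌉ p q ≤? + 2
      ... | yes a≤2 = a≤2
      ... | no  a≰2 = ⊥-elim (NonNeg⇒≢-1
          (≤⇒NonNeg (proj₁ (δ-bounds p q arc)) ⊕ <⇒NonNeg (≰⇒> a≰2) ⊗ NonNeg-ℕ k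
            ⊕ <⇒NonNeg (proj₁ (lift-range q)) ⊕ <⇒NonNeg (proj₂ (lift-range p)) ⊕ NonNeg-ℕ d ⊕ NonNeg-ℕ 1)
          (certificate (⌈δ⌉ p q) (lift p) (lift q) (+ k) (+ d)))
        where certificate : ∀ a x y k d → y - x - ((a - 1ℤ) * k + d) + (a - + 2 - 1ℤ) * k + (k - y - 1ℤ) + (x - - k - 1ℤ) + d + + 1 ≡ -1ℤ
              certificate = solve-∀

      ⌈δ⌉+⌈δ⌉≤1 : ∀ p q → Arc p q ≡ true → ⌈δ⌉ p q + ⌈δ⌉ q p ≤ 1ℤ
      ⌈δ⌉+⌈δ⌉≤1 p q arc with ⌈δ⌉ p q + ⌈δ⌉ q p ≤? 1ℤ
      ... | yes a+a′≤1 = a+a′≤1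
      ... | no  a+a′≰1 = ⊥-elim (NonNeg⇒≢-1
          (≤⇒NonNeg (proj₁ (δ-bounds p q arc)) ⊕ ≤⇒NonNeg (proj₁ (δ-bounds q p (Arc-sym p q arc)))
            ⊕ <⇒NonNeg (≰⇒> a+a′≰1) ⊗ NonNeg-ℕ k ⊕ (d≥1 ⊕ d≥1) ⊕ NonNeg-ℕ 1)
          (certificate (⌈δ⌉ p q) (⌈δ⌉ q p) (lift p) (lift q) (+ k) (+ d)))
        where d≥1 = ℕ≤⇒NonNeg 1≤d
              certificate : ∀ a a′ x y k d → y - x - ((a - 1ℤ) * k + d) + (x - y - ((a′ - 1ℤ) * k + d)) + (a + a′ - 1ℤ - 1ℤ) * k
                                            + ((d - + 1) + (d - + 1)) + + 1 ≡ -1ℤ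
              certificate = solve-∀

      ⌈δ⌉-mirror : ∀ p q → ⌈δ⌉ (mirror q) (mirror p) ≡ ⌈δ⌉ p q
      ⌈δ⌉-mirror p q = cong (λ x → x /ℕ k + 1ℤ) (trans (cong₂ _-_ (lift-mirror p) (lift-mirror q)) (swap (lift p) (lift q)))
        where swap : ∀ x y → - x - - y ≡ y - x
              swap = solve-∀

      module Tension (t m : ℕ) (2≤t : 2 ℕ.≤ t) (close : m ℕ.* k ℕ.< (m ℕ.* t ℕ.+ 1) ℕ.* d)
                     (m-large : 2 ℕ.* suc size ℕ.≤ m) where

        w : Vertex → Vertex → ℤ
        w p q = ⌈δ⌉ p q * + t - 1ℤ

        closed-walk≥0 : ∀ v l → l ℕ.≤ suc size → IsWalk v l → v l ≡ v 0 → NonNeg (weight w v l)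
        closed-walk≥0 v zero     _   _ _      = NonNeg-ℕ 0
        closed-walk≥0 v l@(suc _) l≤ W closed =
          subst NonNeg (trans (affine A (+ l) (+ t)) (sym (weight-affine ⌈δ⌉ (+ t) -1ℤ v l)))
            (≤⇒NonNeg (closed-walk-bound (+≤+ (s≤s z≤n)) (+≤+ 1≤d) (NonNeg-ℕ k) (NonNeg-ℕ m) lD≤Ak A≤2l 2l≤m mk<[mt+1]d))
          where
            A = weight ⌈δ⌉ v l
            affine : ∀ A l t → A * t - l ≡ A * t + l * -1ℤ
            affine = solve-∀
            Σδ≡0 : weight δ v l ≡ 0ℤ
            Σδ≡0 = trans (weight-tele lift v l) (trans (cong (λ p → lift p - lift (v 0)) closed) (+-inverseʳ (lift (v 0))))
            0≤Ak-ld : 0ℤ ≤ A * + k + + l * - + d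
            0≤Ak-ld = begin
              0ℤ                              ≡⟨ sym Σδ≡0 ⟩
              weight δ v l                    ≤⟨ weight-mono v l W (λ p q arc → proj₂ (δ-bounds p q arc)) ⟩
              weight (λ p q → ⌈δ⌉ p q * + k - + d) v l ≡⟨ weight-affine ⌈δ⌉ (+ k) (- + d) v l ⟩
              A * + k + + l * - + d           ∎
              where open ≤-Reasoning
            lD≤Ak : + l * + d ≤ A * + k
            lD≤Ak = NonNeg⇒≤ (subst NonNeg (rearrange A (+ l) (+ k) (+ d)) 0≤Ak-ld)
              where rearrange : ∀ A l k d → A * k + l * - d ≡ A * k - l * d
                    rearrange = solve-∀
            A≤2l : A ≤ + l * + 2
            A≤2l = ≤-trans (weight-mono v l W (λ p q arc → ⌈δ⌉≤2 p q arc)) (≤-reflexive (weight-const (+ 2) v l))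
            2l≤m : + l * + 2 ≤ + m
            2l≤m = subst (_≤ + m) (pos-* l 2)
                     (+≤+ (ℕₚ.≤-trans (ℕₚ.*-monoˡ-≤ 2 l≤) (ℕₚ.≤-trans (ℕₚ.≤-reflexive (ℕₚ.*-comm (suc size) 2)) m-large)))
            mk<[mt+1]d : + m * + k < (+ m * + t + 1ℤ) * + d
            mk<[mt+1]d = subst₂ _<_ (pos-* m k)
                           (trans (pos-* (m ℕ.* t ℕ.+ 1) d) (cong (_* + d) (trans (pos-+ (m ℕ.* t) 1) (cong (_+ 1ℤ) (pos-* m t)))))
                           (+<+ close)

        open ShortestWalks size encode decode decode∘encode w closed-walk≥0

        π : Vertex → ℤ
        π = shortest size

        X : Vertex → ℤ
        X p = π p - π (mirror p)

        X-step : ∀ p q → Arc p q ≡ true → X q - X p ≤ + 2 * w p q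
        X-step p q arc = NonNeg⇒≤ (subst NonNeg (rearrange (π p) (π q) (π (mirror p)) (π (mirror q)) (w p q))
                                     (≤⇒NonNeg (shortest-feasible arc) ⊕ ≤⇒NonNeg mirrored))
          where
            mirrored : π (mirror p) ≤ π (mirror q) + w p q
            mirrored = subst (λ x → π (mirror p) ≤ π (mirror q) + x) (cong (λ a → a * + t - 1ℤ) (⌈δ⌉-mirror p q))
                             (shortest-feasible (Arc-mirror p q arc))
            rearrange : ∀ πp πq πp′ πq′ w → πp + w - πq + (πq′ + w - πp′) ≡ + 2 * w - ((πq - πq′) - (πp - πp′))
            rearrange = solve-∀

        X-Apart : ∀ p q → Arc p q ≡ true → Apart (2 ℕ.* t) 2 (X q - X p)
        X-Apart p q arc = Apart-between {a = ⌈δ⌉ p q} {⌈δ⌉ q p} (X-step p q arc)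
                            (subst (_≤ _) (swap (X q) (X p)) (X-step q p (Arc-sym p q arc))) (⌈δ⌉+⌈δ⌉≤1 p q arc)
          where swap : ∀ x y → y - x ≡ - (x - y)
                swap = solve-∀

        X-sign : ∀ v s → X (v , s) ≡ signℤ s * X (v , Sign.+)
        X-sign v Sign.+ = sym (*-identityˡ _)
        X-sign v Sign.- = antisym (π (v , Sign.+)) (π (v , Sign.-))
          where antisym : ∀ x y → y - x ≡ -1ℤ * (x - y)
                antisym = solve-∀

        instance
          2t-nonZero : ℕ.NonZero (2 ℕ.* t)
          2t-nonZero = ℕ.>-nonZero (ℕₚ.<-≤-trans (s≤s z≤n) (ℕₚ.*-monoʳ-≤ 2 (ℕₚ.≤-trans (s≤s z≤n) 2≤t)))

        colour : Fin n → Fin (2 ℕ.* t)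
        colour v = fromℕ< (n%ℕd<d (X (v , Sign.+)) (2 ℕ.* t))

        toℕ-colour : ∀ v → toℕ (colour v) ≡ X (v , Sign.+) %ℕ (2 ℕ.* t)
        toℕ-colour v = Finₚ.toℕ-fromℕ< (n%ℕd<d (X (v , Sign.+)) (2 ℕ.* t))

        colour-isColoring : IsColoring G (2 ℕ.* t) 2 colour
        colour-isColoring = s≤s z≤n , ℕₚ.*-monoʳ-≤ 2 2≤t , λ u v edge →
          Apart⇒absMod (2 ℕ.* t) _
            (subst₂ (λ x y → Apart (2 ℕ.* t) 2 (+ x - (σ u v ◃ y))) (sym (toℕ-colour u)) (sym (toℕ-colour v))
              (Apart-%ℕ (2 ℕ.* t) (σ u v) (X (u , Sign.+)) (X (v , Sign.+))
                (subst (λ x → Apart (2 ℕ.* t) 2 (x - X (u , Sign.+))) (X-sign v (σ u v))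
                  (X-Apart (u , Sign.+) (v , σ u v) (edge⇒arc {u} {Sign.+} {v} edge refl)))))

  module Rounding (G : SignedGraph) (k d t : ℕ) .{{_ : ℕ.NonZero k}} (2≤t : 2 ℕ.≤ t) (k<td : k ℕ.< t ℕ.* d)
                  (c : Fin (SignedGraph.n G) → Fin k)
                  (c-apart : ∀ u v → SignedGraph.E G u v ≡ true →
                             Apart k d (+ toℕ (c u) - (SignedGraph.σ G u v ◃ toℕ (c v)))) where
    open SignedGraph G

    instance
      2k-nonZero : ℕ.NonZero (2 ℕ.* k)
      2k-nonZero = ℕ.>-nonZero (ℕₚ.<-≤-trans (ℕ.>-nonZero⁻¹ k) (ℕₚ.m≤m+n k (k ℕ.+ 0)))
      t-nonZero : ℕ.NonZero t
      t-nonZero = ℕ.>-nonZero (ℕₚ.<-≤-trans (s≤s z≤n) 2≤t)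

    scaled : ℕ → ℤ
    scaled x = + 2 * + t * + x + + k

    -- t x / k rounded to the nearest integer.
    round : ℕ → ℤ
    round x = scaled x /ℕ (2 ℕ.* k)

    residue : ℕ → ℤ
    residue x = + (scaled x %ℕ (2 ℕ.* k))

    scaled≡ : ∀ x → scaled x ≡ residue x + round x * (+ 2 * + k)
    scaled≡ x = trans (a≡a%ℕn+[a/ℕn]*n (scaled x) (2 ℕ.* k)) (cong (λ K → residue x + round x * K) (pos-* 2 k))

    residue<2k : ∀ x → residue x < + 2 * + k
    residue<2k x = subst (residue x <_) (pos-* 2 k) (+<+ (n%ℕd<d (scaled x) (2 ℕ.* k)))

    rescale : ∀ e x y → + 2 * + k * (round x - e * round y) ≡ + 2 * + t * (+ x - e * + y) - ((residue x - + k) - e * (residue y - + k))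
    rescale e x y = i-j≡0⇒i≡j _ _ (begin
      + 2 * + k * (round x - e * round y) - (+ 2 * + t * (+ x - e * + y) - ((residue x - + k) - e * (residue y - + k)))
        ≡⟨ identity e (+ x) (+ y) (residue x) (residue y) (round x) (round y) (+ k) (+ t) ⟩
      (residue x + round x * (+ 2 * + k) - scaled x) - e * (residue y + round y * (+ 2 * + k) - scaled y)
        ≡⟨ cong₂ (λ a b → a - e * b) (i≡j⇒i-j≡0 (sym (scaled≡ x))) (i≡j⇒i-j≡0 (sym (scaled≡ y))) ⟩
      0ℤ - e * 0ℤ
        ≡⟨ cong (λ z → 0ℤ - z) (*-zeroʳ e) ⟩
      0ℤ ∎)
      where
        open ≡-Reasoning
        identity : ∀ e x y ρx ρy Rx Ry K T →
                   + 2 * K * (Rx - e * Ry) - (+ 2 * T * (x - e * y) - ((ρx - K) - e * (ρy - K)))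
                   ≡ (ρx + Rx * (+ 2 * K) - (+ 2 * T * x + K)) - e * (ρy + Ry * (+ 2 * K) - (+ 2 * T * y + K))
        identity = solve-∀

    colour : Fin n → Fin t
    colour v = fromℕ< (n%ℕd<d (round (toℕ (c v))) t)

    toℕ-colour : ∀ v → toℕ (colour v) ≡ round (toℕ (c v)) %ℕ t
    toℕ-colour v = Finₚ.toℕ-fromℕ< (n%ℕd<d (round (toℕ (c v))) t)

    round-Apart : ∀ s x y → Apart k d (+ x - signℤ s * + y) → Apart t 1 (signℤ s * round y - round x)
    round-Apart s x y x-apart =
      subst (Apart t 1) (negate (signℤ s) (round x) (round y))
        (Apart-neg (Apart-round x-apart k<td (rescale (signℤ s) x y)
                    (proj₁ Δ-bounds) (proj₂ Δ-bounds)))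
      where
        Δ-bounds = rounding-error s {K = + k} (+≤+ z≤n) (residue<2k x) (+≤+ z≤n) (residue<2k y)
        negate : ∀ e a b → - (a - e * b) ≡ e * b - a
        negate = solve-∀

    colour-isColoring : IsColoring G t 1 colour
    colour-isColoring = ℕₚ.≤-refl , 2≤t , λ u v edge →
      Apart⇒absMod t _
        (subst₂ (λ x y → Apart t 1 (+ x - (σ u v ◃ y))) (sym (toℕ-colour u)) (sym (toℕ-colour v))
          (Apart-%ℕ t (σ u v) (round (toℕ (c u))) (round (toℕ (c v)))
            (round-Apart (σ u v) (toℕ (c u)) (toℕ (c v))
              (subst (λ y → Apart k d (+ toℕ (c u) - y)) (◃≡signℤ* (σ u v) (toℕ (c v))) (c-apart u v edge)))))

  modulus-nonZero : ∀ {k d} → 1 ℕ.≤ d → 2 ℕ.* d ℕ.≤ k → ℕ.NonZero k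
  modulus-nonZero 1≤d 2d≤k = ℕ.>-nonZero (ℕₚ.<-≤-trans (s≤s z≤n) (ℕₚ.≤-trans (ℕₚ.*-monoʳ-≤ 2 1≤d) 2d≤k))

  IsColoring⇒Apart : ∀ G {k d c} .{{_ : ℕ.NonZero k}} → IsColoring G k d c →
                     ∀ u v → SignedGraph.E G u v ≡ true → Apart k d (+ toℕ (c u) - (SignedGraph.σ G u v ◃ toℕ (c v)))
  IsColoring⇒Apart G {k} (_ , _ , edges) u v edge = absMod⇒Apart k _ (edges u v edge)

  HasColoring-rounded : ∀ G {k d t} → 2 ℕ.≤ t → k ℕ.< t ℕ.* d → HasColoring G k d → HasColoring G t 1
  HasColoring-rounded G {k} {d} {t} 2≤t k<td (c , col@(1≤d , 2d≤k , _)) = colour , colour-isColoring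
    where
      instance _ = modulus-nonZero 1≤d 2d≤k
      open Rounding G k d t 2≤t k<td c (IsColoring⇒Apart G {c = c} col)

  ratio-close⇒2≤t : ∀ {m k d t} → 1 ℕ.≤ m → 2 ℕ.* d ℕ.≤ k → m ℕ.* k ℕ.< (m ℕ.* t ℕ.+ 1) ℕ.* d → 2 ℕ.≤ t
  ratio-close⇒2≤t {m} {k} {d} {t} 1≤m 2d≤k close with 2 ℕ.≤? t
  ... | yes 2≤t = 2≤t
  ... | no  2≰t = ⊥-elim (ℕₚ.<-irrefl refl (ℕₚ.<-≤-trans close (begin
        (m ℕ.* t ℕ.+ 1) ℕ.* d   ≤⟨ ℕₚ.*-monoˡ-≤ d (ℕₚ.+-mono-≤ (ℕₚ.*-monoʳ-≤ m (ℕₚ.≤-pred (ℕₚ.≰⇒> 2≰t))) 1≤m) ⟩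
        (m ℕ.* 1 ℕ.+ m) ℕ.* d   ≡⟨ regroup m d ⟩
        m ℕ.* (2 ℕ.* d)         ≤⟨ ℕₚ.*-monoʳ-≤ m 2d≤k ⟩
        m ℕ.* k                 ∎)))
    where
      open ℕₚ.≤-Reasoning
      regroup : ∀ m d → (m ℕ.* 1 ℕ.+ m) ℕ.* d ≡ m ℕ.* (2 ℕ.* d)
      regroup = ℕ-solve-∀

  HasColoring-from-close-ratio : ∀ G {k d t m} → 2 ℕ.* suc (SignedGraph.n G ℕ.+ SignedGraph.n G) ℕ.≤ m →
                                 m ℕ.* k ℕ.< (m ℕ.* t ℕ.+ 1) ℕ.* d → HasColoring G k d → HasColoring G (2 ℕ.* t) 2
  HasColoring-from-close-ratio G {k} {d} {t} {m} m-large close (c , col@(1≤d , 2d≤k , _)) = colour , colour-isColoring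
    where
      instance _ = modulus-nonZero 1≤d 2d≤k
      1≤m = ℕₚ.≤-trans (s≤s z≤n) m-large
      open Cover.Lift.Tension G k d c 1≤d (IsColoring⇒Apart G {c = c} col) t m (ratio-close⇒2≤t 1≤m 2d≤k close) close m-large

open import Data.Nat using (_*_)

2t/2<t+1/m : ∀ m t → m * (2 * t) ℕ.< (m * t ℕ.+ 1) * 2
2t/2<t+1/m m t = subst (m * (2 * t) ℕ.<_) (sym (regroup m t)) (ℕₚ.m<m+n (m * (2 * t)) (s≤s z≤n))
  where regroup : ∀ m t → (m * t ℕ.+ 1) * 2 ≡ m * (2 * t) ℕ.+ 2
        regroup = ℕ-solve-∀

theorem15 : (G : SignedGraph) (t : ℕ) → ChromaticNumberIs G (suc t) →
    (CircularChromaticNumberIs G t ⇔ HasColoring G (2 * t) 2)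
theorem15 G t (_ , no-smaller-coloring) = mk⇔ to from
  where
    open SignedGraph G using (n)
    to : CircularChromaticNumberIs G t → HasColoring G (2 * t) 2
    to (_ , approximations) with approximations (2 * suc (n ℕ.+ n)) (s≤s z≤n)
    ... | _ , _ , coloring , close = HasColoring-from-close-ratio G {t = t} ℕₚ.≤-refl close coloring
    from : HasColoring G (2 * t) 2 → CircularChromaticNumberIs G t
    from coloring@(_ , _ , 4≤2t , _) = lower-bound , λ m _ → 2 * t , 2 , coloring , 2t/2<t+1/m m t
      where
        lower-bound : ∀ k d → HasColoring G k d → t * d ℕ.≤ k
        lower-bound k d col with t * d ℕ.≤? k
        ... | yes td≤k = td≤k
        ... | no  td≰k = ⊥-elim (no-smaller-coloring t (ℕₚ.n<1+n t)
                                   (HasColoring-rounded G (ℕₚ.*-cancelˡ-≤ 2 4≤2t) (ℕₚ.≰⇒> td≰k) col))
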